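{- Let $A$ be a commutative algebra over a field containing $\mathbb{Q}(q)$, let $F,G\in A[[t]]$ with $F(0)=0$. Then \[ D_q\big(G[F]^*_q\big)(t)=\Big((D_qG)\big[q^{ -1}F\big]^*_q\Big)(qt)\cdot D_qF(t). \]
   Context: $[n]_q=1+q+\cdots+q^{n-1}$ ($n\ge1$), $[0]_q=0$, $[n]_q!=[1]_q\cdots[n]_q$, $[0]_q!=1$; $D_qF(t)=\frac{F(qt)-F(t)}{(q-1)t}$. For $F\in A[[t]]$ with $F(0)=0$: $F^{[0]^*}=1$ and for $k\ge1$, $F^{[k]^*}$ is the unique series with zero constant term such that $D_qF^{[k]^*}(t)=[k]_q\,q^{ -(k-1)}F^{[k-1]^*}(qt)\,D_qF(t)$. For $G(t)=\sum_{k\ge0}g_kt^k/[k]_q!$, the $q^*$-composition is $G[F]^*_q=\sum_{k\ge0}g_kF^{[k]^*}/[k]_q!$. -}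

module Defs where

open import Level using (Level; _⊔_)
open import Data.Nat as ℕ using (ℕ; zero; suc; _∸_)
open import Data.Integer as ℤ using (ℤ; +_; -[1+_])
open import Data.List using (List; []; _∷_)
open import Data.List.Relation.Unary.Any using (Any)
open import Algebra.Bundles using (CommutativeRing)
open import Relation.Nullary using (¬_)

-- Fields.  A field is a commutative ring with 0 ≉ 1 together with an
-- inverse operation that is a two-sided inverse on non-zero elements
-- (the value of 0⁻¹ is irrelevant / unconstrained).

record Field (c ℓ : Level) : Set (Level.suc (c ⊔ ℓ)) where
  field
    commRing : CommutativeRing c ℓ
  open CommutativeRing commRing public hiding (ring)
  field
    _⁻¹     : Carrier → Carrier
    0≉1     : ¬ (0# ≈ 1#)
    inverse : ∀ x → ¬ (x ≈ 0#) → (x * (x ⁻¹)) ≈ 1#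

module RingOps {c ℓ} (R : CommutativeRing c ℓ) where
  open CommutativeRing R using (Carrier; _≈_; _+_; _*_; -_; _-_; 0#; 1#)

  natR : ℕ → Carrier
  natR zero    = 0#
  natR (suc n) = 1# + natR n

  intR : ℤ → Carrier
  intR (+ n)     = natR n
  intR -[1+ n ]  = - natR (suc n)

  pow : Carrier → ℕ → Carrier
  pow x zero    = 1#
  pow x (suc n) = x * pow x n

  evalPoly : List ℤ → Carrier → Carrier
  evalPoly []       x = 0#
  evalPoly (a ∷ as) x = intR a + x * evalPoly as x

  sumTo : ℕ → (ℕ → Carrier) → Carrier
  sumTo zero    f = f zero
  sumTo (suc n) f = sumTo n f + f (suc n)

-- "K contains ℚ(q)": q ∈ K is transcendental over ℚ and K has
-- characteristic 0, i.e. every nonzero integer polynomial is nonzero at q.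
-- (Then the subfield generated by q is isomorphic to ℚ(q).)

module _ {c ℓ} (K : Field c ℓ) where
  open Field K using (Carrier; _≈_; 0#; commRing)
  open RingOps commRing

  NonZeroPoly : List ℤ → Set
  NonZeroPoly as = Any (λ a → ¬ (a ≡ℤ ℤ.0ℤ)) as
    where
    open import Relation.Binary.PropositionalEquality renaming (_≡_ to _≡ℤ_)

  ContainsℚOf : Carrier → Set ℓ
  ContainsℚOf q = ∀ (p : List ℤ) → NonZeroPoly p → ¬ (evalPoly p q ≈ 0#)

record Algebra {c ℓ} (K : Field c ℓ) (a ℓa : Level) : Set (c ⊔ ℓ ⊔ Level.suc (a ⊔ ℓa)) where
  field
    ring : CommutativeRing a ℓa
  module A = CommutativeRing ring
  module K = Field K
  field
    φ       : K.Carrier → A.Carrier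
    φ-cong  : ∀ {x y} → x K.≈ y → φ x A.≈ φ y
    φ-+     : ∀ x y → φ (x K.+ y) A.≈ (φ x A.+ φ y)
    φ-*     : ∀ x y → φ (x K.* y) A.≈ (φ x A.* φ y)
    φ-1     : φ K.1# A.≈ A.1#

-- Formal power series over A, q-calculus and q*-composition.
-- A series F ∈ A[[t]] is its (ordinary) coefficient sequence: F n is the
-- coefficient of t^n.

module QSeries {c ℓ a ℓa} (K : Field c ℓ) (q : Field.Carrier K)
               (Alg : Algebra K a ℓa) where
  open Algebra Alg using (φ) renaming (ring to Aring)
  module KK = Field K
  open CommutativeRing Aring public using (Carrier; _≈_; _+_; _*_; -_; _-_; 0#; 1#)
  module RK = RingOps KK.commRing
  open RingOps Aring

  Series : Set a
  Series = ℕ → Carrier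

  qint : ℕ → KK.Carrier
  qint zero    = KK.0#
  qint (suc n) = KK.1# KK.+ (q KK.* qint n)

  qfact : ℕ → KK.Carrier
  qfact zero    = KK.1#
  qfact (suc n) = qfact n KK.* qint (suc n)

  oneS : Series
  oneS zero    = 1#
  oneS (suc n) = 0#

  scale : KK.Carrier → Series → Series
  scale λ' F n = φ λ' * F n

  atQ : Series → Series
  atQ F n = pow (φ q) n * F n

  _·_ : Series → Series → Series
  (F · G) n = sumTo n (λ i → F i * G (n ∸ i))

  -- D_q F(t) = (F(qt) - F(t)) / ((q-1) t); the numerator has zero constant
  -- term, so division by t is a shift of coefficients.
  Dq : Series → Series
  Dq F n = φ ((q KK.- KK.1#) KK.⁻¹) * (atQ F (suc n) - F (suc n))

  -- F^{[k]*}: the unique series with zero constant term such that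
  -- D_q F^{[k]*}(t) = [k]_q q^{-(k-1)} F^{[k-1]*}(qt) D_q F(t).
  -- Since the t^n-coefficient of D_q H is [n+1]_q h_{n+1}, this is the
  -- coefficient recursion below.
  qpow : Series → ℕ → Series
  qpow F zero          = oneS
  qpow F (suc k) zero    = 0#
  qpow F (suc k) (suc n) =
    φ (qint (suc n) KK.⁻¹) *
      ( φ (qint (suc k) KK.* RK.pow (q KK.⁻¹) k)
        * (atQ (qpow F k) · Dq F) n )

  -- q*-composition G[F]^*_q = Σ_k g_k F^{[k]*} / [k]_q!, where
  -- G(t) = Σ_k g_k t^k / [k]_q!, i.e. g_k = [k]_q! · (t^k-coefficient of G).
  -- Since F(0) = 0, F^{[k]*} has order ≥ k, so the t^n-coefficient of the
  -- sum only involves k ≤ n.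
  qcomp : Series → Series → Series
  qcomp G F n =
    sumTo n (λ k → (φ (qfact k) * G k) * φ (qfact k KK.⁻¹) * qpow F k n)

-- On coefficients, D_q multiplies the t^(n+1)-coefficient by [n+1]_q, and the
-- defining recursion of F^{[k+1]*} says that [n+1]_q times its t^(n+1)-coefficient
-- is [k+1]_q q^{-k} times the t^n-coefficient of F^{[k]*}(qt) D_q F(t).  Hence both
-- sides of the identity expand to the same double sum over k ≤ i ≤ n, once one
-- knows that (q⁻¹F)^{[k]*} = q^{-k} F^{[k]*} and that F^{[k]*} has order ≥ k.
-- The only facts about q used are [n]_q ≠ 0 for n ≥ 1 and q ≠ 1.
module Submission where

open import Defs
open import Level using (Level)
open import Data.Nat as ℕ using (ℕ; zero; suc; _∸_; _<_; _≤_; s≤s; z≤n)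
import Data.Nat.Properties as ℕP
open import Data.Integer using (ℤ; +_; -[1+_])
open import Data.List using (List; []; _∷_)
open import Data.List.Relation.Unary.Any using (here)
open import Relation.Nullary using (¬_)
open import Relation.Binary.PropositionalEquality using (subst)
open import Algebra.Bundles using (CommutativeRing)
import Algebra.Solver.Ring.NaturalCoefficients.Default as Solver
import Relation.Binary.Reasoning.Setoid as SetoidReasoning

module Sums {c ℓ} (R : CommutativeRing c ℓ) where
  open CommutativeRing R
  open RingOps R
  open SetoidReasoning setoid
  open Solver commutativeSemiring using (solve; _:=_; _:+_)

  sumTo-cong : ∀ n {f g} → (∀ i → i ≤ n → f i ≈ g i) → sumTo n f ≈ sumTo n g
  sumTo-cong zero    f≈g = f≈g 0 z≤n
  sumTo-cong (suc n) f≈g =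
    +-cong (sumTo-cong n (λ i i≤n → f≈g i (ℕP.m≤n⇒m≤1+n i≤n))) (f≈g (suc n) ℕP.≤-refl)

  sumTo-zero : ∀ n f → (∀ i → i ≤ n → f i ≈ 0#) → sumTo n f ≈ 0#
  sumTo-zero n f f≈0 = trans (sumTo-cong n f≈0) (zeros n)
    where
    zeros : ∀ n → sumTo n (λ _ → 0#) ≈ 0#
    zeros zero    = refl
    zeros (suc n) = trans (+-identityʳ _) (zeros n)

  sumTo-+ : ∀ n f g → sumTo n (λ i → f i + g i) ≈ sumTo n f + sumTo n g
  sumTo-+ zero    f g = refl
  sumTo-+ (suc n) f g = begin
    sumTo n (λ i → f i + g i) + (f (suc n) + g (suc n)) ≈⟨ +-cong (sumTo-+ n f g) refl ⟩
    (sumTo n f + sumTo n g) + (f (suc n) + g (suc n))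
      ≈⟨ solve 4 (λ a b c d → (a :+ b) :+ (c :+ d) := (a :+ c) :+ (b :+ d)) refl _ _ _ _ ⟩
    (sumTo n f + f (suc n)) + (sumTo n g + g (suc n)) ∎

  *-distribˡ-sumTo : ∀ n x f → x * sumTo n f ≈ sumTo n (λ i → x * f i)
  *-distribˡ-sumTo zero    x f = refl
  *-distribˡ-sumTo (suc n) x f = trans (distribˡ x _ _) (+-cong (*-distribˡ-sumTo n x f) refl)

  *-distribʳ-sumTo : ∀ n x f → sumTo n f * x ≈ sumTo n (λ i → f i * x)
  *-distribʳ-sumTo n x f =
    trans (*-comm _ x) (trans (*-distribˡ-sumTo n x f) (sumTo-cong n (λ i _ → *-comm x (f i))))

  sumTo-head : ∀ n f → sumTo (suc n) f ≈ f 0 + sumTo n (λ i → f (suc i))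
  sumTo-head zero    f = refl
  sumTo-head (suc n) f = trans (+-cong (sumTo-head n f) refl) (+-assoc _ _ _)

  sumTo-comm : ∀ m n (a : ℕ → ℕ → Carrier) →
               sumTo m (λ i → sumTo n (a i)) ≈ sumTo n (λ j → sumTo m (λ i → a i j))
  sumTo-comm zero    n a = refl
  sumTo-comm (suc m) n a = trans (+-cong (sumTo-comm m n a) refl) (sym (sumTo-+ n _ _))

  sumTo-truncate : ∀ {i n} f → i ≤ n → (∀ j → i < j → f j ≈ 0#) → sumTo n f ≈ sumTo i f
  sumTo-truncate {i} f i≤n f≈0 =
    subst (λ n → sumTo n f ≈ sumTo i f) (ℕP.m∸n+n≡m i≤n) (extend (_ ∸ i))
    where
    extend : ∀ k → sumTo (k ℕ.+ i) f ≈ sumTo i f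
    extend zero    = refl
    extend (suc k) = trans (+-cong (extend k) (f≈0 _ (s≤s (ℕP.m≤n+m i k)))) (+-identityʳ _)

module FieldProperties {c ℓ} (K : Field c ℓ) where
  open Field K
  open SetoidReasoning setoid

  *-≉0 : ∀ {x y} → ¬ (x ≈ 0#) → ¬ (y ≈ 0#) → ¬ (x * y ≈ 0#)
  *-≉0 {x} {y} x≉0 y≉0 xy≈0 = x≉0 (begin
    x                ≈⟨ sym (*-identityʳ x) ⟩
    x * 1#           ≈⟨ *-cong refl (sym (inverse y y≉0)) ⟩
    x * (y * y ⁻¹)   ≈⟨ sym (*-assoc x y _) ⟩
    (x * y) * y ⁻¹   ≈⟨ *-cong xy≈0 refl ⟩
    0# * y ⁻¹        ≈⟨ zeroˡ _ ⟩
    0#               ∎)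

module QNumbers {c ℓ a ℓa} (K : Field c ℓ) (q : Field.Carrier K) (q-generic : ContainsℚOf K q)
                (Alg : Algebra K a ℓa) where
  open QSeries K q Alg using (qint; qfact)
  open Field K
  open RingOps commRing
  open FieldProperties K
  open SetoidReasoning setoid
  open Solver commutativeSemiring using (solve; _:=_; _:+_; _:*_; con)

  qint-poly : ℕ → List ℤ
  qint-poly zero    = []
  qint-poly (suc n) = + 1 ∷ qint-poly n

  eval-qint-poly : ∀ n → evalPoly (qint-poly n) q ≈ qint n
  eval-qint-poly zero    = refl
  eval-qint-poly (suc n) = +-cong (+-identityʳ 1#) (*-cong refl (eval-qint-poly n))

  qint-suc≉0 : ∀ n → ¬ (qint (suc n) ≈ 0#)
  qint-suc≉0 n [n+1]≈0 =
    q-generic (qint-poly (suc n)) (here λ ()) (trans (eval-qint-poly (suc n)) [n+1]≈0)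

  qfact≉0 : ∀ n → ¬ (qfact n ≈ 0#)
  qfact≉0 zero    1≈0 = 0≉1 (sym 1≈0)
  qfact≉0 (suc n) = *-≉0 (qfact≉0 n) (qint-suc≉0 n)

  q-1≉0 : ¬ (q - 1# ≈ 0#)
  q-1≉0 q-1≈0 = q-generic (-[1+ 0 ] ∷ + 1 ∷ []) (here λ ()) (trans eval-q-1 q-1≈0)
    where
    eval-q-1 : - (1# + 0#) + q * ((1# + 0#) + q * 0#) ≈ q - 1#
    eval-q-1 = begin
      - (1# + 0#) + q * ((1# + 0#) + q * 0#)
        ≈⟨ +-cong (-‿cong (+-identityʳ 1#))
                  (*-cong refl (trans (+-cong (+-identityʳ 1#) (zeroʳ q)) (+-identityʳ 1#))) ⟩
      - 1# + q * 1#  ≈⟨ +-cong refl (*-identityʳ q) ⟩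
      - 1# + q       ≈⟨ +-comm _ _ ⟩
      q - 1#         ∎

  q≈[q-1]+1 : q ≈ (q - 1#) + 1#
  q≈[q-1]+1 = sym (begin
    (q - 1#) + 1#     ≈⟨ +-assoc q _ _ ⟩
    q + (- 1# + 1#)   ≈⟨ +-cong refl (-‿inverseˡ 1#) ⟩
    q + 0#            ≈⟨ +-identityʳ q ⟩
    q                 ∎)

  pow-q≈[q-1]qint+1 : ∀ m → pow q m ≈ (q - 1#) * qint m + 1#
  pow-q≈[q-1]qint+1 zero    = sym (trans (+-cong (zeroʳ _) refl) (+-identityˡ 1#))
  pow-q≈[q-1]qint+1 (suc m) = begin
    q * pow q m                          ≈⟨ *-cong q≈[q-1]+1 (pow-q≈[q-1]qint+1 m) ⟩
    (d + 1#) * (d * qint m + 1#)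
      ≈⟨ solve 2 (λ x y → (x :+ con 1) :* ((x :* y) :+ con 1)
                           := (x :* (con 1 :+ ((x :+ con 1) :* y))) :+ con 1) refl d (qint m) ⟩
    d * (1# + (d + 1#) * qint m) + 1#    ≈⟨ +-cong (*-cong refl (+-cong refl (*-cong (sym q≈[q-1]+1) refl))) refl ⟩
    d * (1# + q * qint m) + 1#           ∎
    where
    d : Carrier
    d = q - 1#

module QComposition {c ℓ a ℓa : Level} (K : Field c ℓ) (q : Field.Carrier K)
                    (q-generic : ContainsℚOf K q) (Alg : Algebra K a ℓa) where
  open QSeries K q Alg
  open Algebra Alg using (φ; φ-cong; φ-+; φ-*; φ-1) renaming (ring to A)
  open CommutativeRing A
    using ( refl; sym; trans; +-cong; *-cong; zeroʳ; zeroˡ; +-identityˡ; +-identityʳ; *-identityˡ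
          ; +-assoc; distribʳ; -‿inverseʳ; setoid )
  open RingOps A
  open Sums A
  open QNumbers K q q-generic Alg
  open SetoidReasoning setoid
  open Solver (CommutativeRing.commutativeSemiring A) using (solve; _:=_; _:*_)

  φ-pow : ∀ x m → φ (RK.pow x m) ≈ pow (φ x) m
  φ-pow x zero    = φ-1
  φ-pow x (suc m) = trans (φ-* x _) (*-cong refl (φ-pow x m))

  φ-inverse : ∀ x → ¬ (x KK.≈ KK.0#) → φ x * φ (x KK.⁻¹) ≈ 1#
  φ-inverse x x≉0 = trans (sym (φ-* x _)) (trans (φ-cong (KK.inverse x x≉0)) φ-1)

  cancelˡ : ∀ x y → ¬ (x KK.≈ KK.0#) → (φ x * φ (x KK.⁻¹)) * y ≈ y
  cancelˡ x y x≉0 = trans (*-cong (φ-inverse x x≉0) refl) (*-identityˡ y)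

  [a+1]x-x≈ax : ∀ a x → (a + 1#) * x - x ≈ a * x
  [a+1]x-x≈ax a x = begin
    (a + 1#) * x - x         ≈⟨ +-cong (trans (distribʳ x a 1#) (+-cong refl (*-identityˡ x))) refl ⟩
    (a * x + x) - x          ≈⟨ +-assoc _ _ _ ⟩
    a * x + (x - x)          ≈⟨ +-cong refl (-‿inverseʳ x) ⟩
    a * x + 0#               ≈⟨ +-identityʳ _ ⟩
    a * x                    ∎

  Dq-coeff : ∀ H n → Dq H n ≈ φ (qint (suc n)) * H (suc n)
  Dq-coeff H n = begin
    φ (d KK.⁻¹) * (pow (φ q) (suc n) * H (suc n) - H (suc n))
      ≈⟨ *-cong refl (+-cong (*-cong φ-q^[n+1] refl) refl) ⟩
    φ (d KK.⁻¹) * ((φ d * φ (qint (suc n)) + 1#) * H (suc n) - H (suc n))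
      ≈⟨ *-cong refl ([a+1]x-x≈ax _ _) ⟩
    φ (d KK.⁻¹) * ((φ d * φ (qint (suc n))) * H (suc n))
      ≈⟨ solve 4 (λ u x y z → u :* ((x :* y) :* z) := (x :* u) :* (y :* z)) refl _ _ _ _ ⟩
    (φ d * φ (d KK.⁻¹)) * (φ (qint (suc n)) * H (suc n))
      ≈⟨ cancelˡ d _ q-1≉0 ⟩
    φ (qint (suc n)) * H (suc n) ∎
    where
    d : KK.Carrier
    d = q KK.- KK.1#
    φ-q^[n+1] : pow (φ q) (suc n) ≈ φ d * φ (qint (suc n)) + 1#
    φ-q^[n+1] = trans (sym (φ-pow q (suc n)))
      (trans (φ-cong (pow-q≈[q-1]qint+1 (suc n))) (trans (φ-+ _ _) (+-cong (φ-* _ _) φ-1)))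

  qcomp-coeff : ∀ G F n → qcomp G F n ≈ sumTo n (λ k → G k * qpow F k n)
  qcomp-coeff G F n = sumTo-cong n λ k _ → begin
    ((φ (qfact k) * G k) * φ (qfact k KK.⁻¹)) * qpow F k n
      ≈⟨ solve 4 (λ x g y z → ((x :* g) :* y) :* z := (x :* y) :* (g :* z)) refl _ _ _ _ ⟩
    (φ (qfact k) * φ (qfact k KK.⁻¹)) * (G k * qpow F k n)
      ≈⟨ cancelˡ (qfact k) _ (qfact≉0 k) ⟩
    G k * qpow F k n ∎

  qpow-vanish : ∀ F {i j} → i < j → qpow F j i ≈ 0#
  qpow-vanish F {zero}  {suc j} _         = refl
  qpow-vanish F {suc i} {suc j} (s≤s i<j) =
    trans (*-cong refl (*-cong refl convolution≈0)) (trans (*-cong refl (zeroʳ _)) (zeroʳ _))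
    where
    convolution≈0 : (atQ (qpow F j) · Dq F) i ≈ 0#
    convolution≈0 = sumTo-zero i _ λ l l≤i →
      trans (*-cong (*-cong refl (qpow-vanish F (ℕP.≤-<-trans l≤i i<j))) refl)
            (trans (*-cong (zeroʳ _) refl) (zeroˡ _))

  Dq-scale : ∀ x F n → Dq (scale x F) n ≈ φ x * Dq F n
  Dq-scale x F n = trans (Dq-coeff (scale x F) n)
    (trans (solve 3 (λ a b y → a :* (b :* y) := b :* (a :* y)) refl _ _ _) (*-cong refl (sym (Dq-coeff F n))))

  qpow-scale : ∀ x F j i → qpow (scale x F) j i ≈ pow (φ x) j * qpow F j i
  qpow-scale x F zero    i       = sym (*-identityˡ _)
  qpow-scale x F (suc j) zero    = sym (zeroʳ _)
  qpow-scale x F (suc j) (suc i) = begin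
    u * (v * sumTo i (λ l → (pow (φ q) l * qpow (scale x F) j l) * Dq (scale x F) (i ∸ l)))
      ≈⟨ *-cong refl (*-cong refl (sumTo-cong i λ l _ →
           trans (*-cong (*-cong refl (qpow-scale x F j l)) (Dq-scale x F (i ∸ l)))
                 (solve 5 (λ ql p y s e → (ql :* (p :* y)) :* (s :* e) := (s :* p) :* ((ql :* y) :* e))
                        refl _ _ _ _ _))) ⟩
    u * (v * sumTo i (λ l → xʲ⁺¹ * ((pow (φ q) l * qpow F j l) * Dq F (i ∸ l))))
      ≈⟨ *-cong refl (*-cong refl (sym (*-distribˡ-sumTo i _ _))) ⟩
    u * (v * (xʲ⁺¹ * sumTo i (λ l → (pow (φ q) l * qpow F j l) * Dq F (i ∸ l))))
      ≈⟨ solve 4 (λ a b s z → a :* (b :* (s :* z)) := s :* (a :* (b :* z))) refl _ _ _ _ ⟩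
    xʲ⁺¹ * (u * (v * sumTo i (λ l → (pow (φ q) l * qpow F j l) * Dq F (i ∸ l)))) ∎
    where
    u v xʲ⁺¹ : Carrier
    u = φ (qint (suc i) KK.⁻¹)
    v = φ (qint (suc j) KK.* RK.pow (q KK.⁻¹) j)
    xʲ⁺¹ = φ x * pow (φ x) j

  module _ (F G : Series) (n : ℕ) where

    summand : ℕ → ℕ → Carrier
    summand i j = (G (suc j) * φ (qint (suc j) KK.* RK.pow (q KK.⁻¹) j))
                * ((pow (φ q) i * qpow F j i) * Dq F (n ∸ i))

    Dq-qcomp≈double-sum : Dq (qcomp G F) n ≈ sumTo n (λ i → sumTo i (summand i))
    Dq-qcomp≈double-sum = begin
      Dq (qcomp G F) n
        ≈⟨ Dq-coeff (qcomp G F) n ⟩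
      φ (qint (suc n)) * qcomp G F (suc n)
        ≈⟨ *-cong refl (trans (qcomp-coeff G F (suc n)) (sumTo-head n _)) ⟩
      φ (qint (suc n)) * (G 0 * 0# + sumTo n (λ j → G (suc j) * qpow F (suc j) (suc n)))
        ≈⟨ *-cong refl (trans (+-cong (zeroʳ _) refl) (+-identityˡ _)) ⟩
      φ (qint (suc n)) * sumTo n (λ j → G (suc j) * qpow F (suc j) (suc n))
        ≈⟨ trans (*-distribˡ-sumTo n _ _) (sumTo-cong n λ j _ → trans
             (solve 5 (λ a g b p y → a :* (g :* (b :* (p :* y))) := (a :* b) :* ((g :* p) :* y)) refl _ _ _ _ _)
             (cancelˡ (qint (suc n)) _ (qint-suc≉0 n))) ⟩
      sumTo n (λ j → (G (suc j) * φ (qint (suc j) KK.* RK.pow (q KK.⁻¹) j))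
                     * sumTo n (λ i → (pow (φ q) i * qpow F j i) * Dq F (n ∸ i)))
        ≈⟨ sumTo-cong n (λ j _ → *-distribˡ-sumTo n _ _) ⟩
      sumTo n (λ j → sumTo n (λ i → summand i j))
        ≈⟨ sumTo-comm n n (λ j i → summand i j) ⟩
      sumTo n (λ i → sumTo n (summand i))
        ≈⟨ sumTo-cong n (λ i i≤n → sumTo-truncate _ i≤n λ j i<j →
             trans (*-cong refl (*-cong (*-cong refl (qpow-vanish F i<j)) refl))
                   (trans (*-cong refl (trans (*-cong (zeroʳ _) refl) (zeroˡ _))) (zeroʳ _))) ⟩
      sumTo n (λ i → sumTo i (summand i)) ∎

    atQ-qcomp·Dq≈double-sum :
      (atQ (qcomp (Dq G) (scale (q KK.⁻¹) F)) · Dq F) n ≈ sumTo n (λ i → sumTo i (summand i))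
    atQ-qcomp·Dq≈double-sum = sumTo-cong n λ i _ → begin
      (pow (φ q) i * qcomp (Dq G) (scale (q KK.⁻¹) F) i) * Dq F (n ∸ i)
        ≈⟨ *-cong (*-cong refl (qcomp-coeff (Dq G) (scale (q KK.⁻¹) F) i)) refl ⟩
      (pow (φ q) i * sumTo i (λ j → Dq G j * qpow (scale (q KK.⁻¹) F) j i)) * Dq F (n ∸ i)
        ≈⟨ trans (*-cong (*-distribˡ-sumTo i _ _) refl) (*-distribʳ-sumTo i _ _) ⟩
      sumTo i (λ j → (pow (φ q) i * (Dq G j * qpow (scale (q KK.⁻¹) F) j i)) * Dq F (n ∸ i))
        ≈⟨ sumTo-cong i (λ j _ → begin
             (pow (φ q) i * (Dq G j * qpow (scale (q KK.⁻¹) F) j i)) * Dq F (n ∸ i)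
               ≈⟨ *-cong (*-cong refl (*-cong (Dq-coeff G j) (qpow-scale (q KK.⁻¹) F j i))) refl ⟩
             (pow (φ q) i * ((φ (qint (suc j)) * G (suc j)) * (pow (φ (q KK.⁻¹)) j * qpow F j i))) * Dq F (n ∸ i)
               ≈⟨ solve 6 (λ qi a g p y e → (qi :* ((a :* g) :* (p :* y))) :* e
                                            := (g :* (a :* p)) :* ((qi :* y) :* e)) refl _ _ _ _ _ _ ⟩
             (G (suc j) * (φ (qint (suc j)) * pow (φ (q KK.⁻¹)) j)) * ((pow (φ q) i * qpow F j i) * Dq F (n ∸ i))
               ≈⟨ *-cong (*-cong refl (sym (trans (φ-* _ _) (*-cong refl (φ-pow (q KK.⁻¹) j))))) refl ⟩
             summand i j ∎) ⟩
      sumTo i (summand i) ∎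

proposition6p4 : ∀ {c ℓ a ℓa : Level} (K : Field c ℓ) (q : Field.Carrier K)
    → ContainsℚOf K q
    → (Alg : Algebra K a ℓa)
    → let open QSeries K q Alg in (F G : Series)
    → F zero ≈ 0#
    → ∀ (n : ℕ) → Dq (qcomp G F) n ≈ (atQ (qcomp (Dq G) (scale (Field._⁻¹ K q) F)) · Dq F) n
proposition6p4 K q q-generic Alg F G _ n =
  trans (Dq-qcomp≈double-sum F G n) (sym (atQ-qcomp·Dq≈double-sum F G n))
  where
  open QComposition K q q-generic Alg
  open CommutativeRing (Algebra.ring Alg) using (trans; sym)
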